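{- (1) For $n\ge1$ and $m\ge2$, $\operatorname{capt}(P_n,m)=n-1$. (2) For $n\ge 2$ and $m\le n-1$, $\operatorname{capt}(K_n,m)=m$. (3) For $n\ge 4$ and $m\le n-1$, $\operatorname{capt}(W_n,m)\le 2m-1$.
   Context: All graphs are reflexive. The game of one cop and $m$ robbers: in round $0$ the cop chooses a starting vertex, then the robbers choose starting vertices (players may share vertices). In each round $i\ge1$ the cop moves to an adjacent vertex or stays, then every robber moves to an adjacent vertex or stays. Whenever the cop occupies the same vertex as some robbers, those robbers are captured and leave the game. For a cop-win graph, $\operatorname{capt}(G,m)$ is the smallest $t$ such that the cop has a strategy guaranteeing all $m$ robbers are captured by round $t$ regardless of the robbers' play. $P_n$ is the path and $K_n$ the complete graph on $n$ vertices; the wheel $W_n$ ($n\ge4$) is the cycle $C_{n-1}$ together with a vertex adjacent to all its vertices. Here $m\ge1$. -}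

module Defs where

open import Data.Nat using (ℕ; zero; suc; _∸_; _<_)
open import Data.Fin using (Fin; toℕ; _≟_)
open import Data.List using (List; []; filter)
open import Data.List.Relation.Binary.Pointwise using (Pointwise)
open import Data.Vec using (Vec; toList)
open import Data.Product using (Σ; _×_)
open import Data.Sum using (_⊎_)
open import Data.Unit using (⊤)
open import Relation.Binary.PropositionalEquality using (_≡_)
open import Relation.Nullary using (¬_)
open import Relation.Nullary.Decidable using (¬?)

-- A finite reflexive graph: vertices Fin V, Adj u v = "u = v or uv is an edge"
-- (closed-neighbourhood relation; a player at u may move to any v with Adj u v).
record Graph : Set₁ where
  field
    V   : ℕ
    Adj : Fin V → Fin V → Set
open Graph public

Refl-Sym : ∀ {n} → (Fin n → Fin n → Set) → Fin n → Fin n → Set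
Refl-Sym E u v = u ≡ v ⊎ E u v ⊎ E v u

path : ℕ → Graph
path n = record { V = n ; Adj = Refl-Sym (λ i j → toℕ j ≡ suc (toℕ i)) }

complete : ℕ → Graph
complete n = record { V = n ; Adj = λ _ _ → ⊤ }

cycleEdge : ∀ {k} → Fin k → Fin k → Set
cycleEdge {k} i j = toℕ j ≡ suc (toℕ i) ⊎ (toℕ i ≡ k ∸ 1 × toℕ j ≡ 0)

-- wheel W_n on Fin n: vertex 0 is the hub, vertices 1,…,n-1 form the cycle C_{n-1}
wheelEdge : ∀ {n} → Fin n → Fin n → Set
wheelEdge Fin.zero _ = ⊤
wheelEdge (Fin.suc i) Fin.zero = ⊤
wheelEdge (Fin.suc i) (Fin.suc j) = cycleEdge i j

wheel : ℕ → Graph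
wheel n = record { V = n ; Adj = Refl-Sym wheelEdge }

capture : ∀ {n} → Fin n → List (Fin n) → List (Fin n)
capture c rs = filter (λ r → ¬? (r ≟ c)) rs

-- Win G t c rs : with the cop at c and remaining robbers at rs (none on c),
-- the cop has a strategy capturing all robbers within t further rounds,
-- against all (adaptive) robber play.
data Win (G : Graph) : ℕ → Fin (V G) → List (Fin (V G)) → Set where
  done : ∀ {t c} → Win G t c []
  step : ∀ {t c rs} (c' : Fin (V G)) → Adj G c c' →
         (∀ (rs' : List (Fin (V G))) →
            Pointwise (Adj G) (capture c' rs) rs' →
            Win G t c' (capture c' rs')) →
         Win G (suc t) c rs

-- The cop can guarantee capture of all m robbers by round t: in round 0 the cop
-- picks c₀, then the robbers pick their start vertices (those on c₀ are captured).
CaptureBy : Graph → ℕ → ℕ → Set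
CaptureBy G m t =
  Σ (Fin (V G)) λ c₀ → ∀ (rs : Vec (Fin (V G)) m) → Win G t c₀ (capture c₀ (toList rs))

IsCapt : Graph → ℕ → ℕ → Set
IsCapt G m t = CaptureBy G m t × (∀ t' → t' < t → ¬ CaptureBy G m t')

-- Upper bounds come from explicit cop strategies: on P_n the cop sweeps from one end to
-- the other, on K_n he jumps onto a robber every round, and on W_n he alternates between
-- jumping from the hub onto a robber and returning to the hub.  Lower bounds come from
-- robbers who never move: the cop then has to visit every robber's vertex, so two robbers
-- at the ends of P_n cost n - 1 rounds, and m robbers on distinct vertices cost m rounds.
-- For W_n only the upper bound is established; since Win is decidable on a finite graph,
-- the least capture time below it exists.
module Submission where

open import Defs
open import Data.Nat using (ℕ; zero; suc; _+_; _*_; _∸_; _≤_; _<_; z≤n; s≤s; ∣_-_∣)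
open import Data.Nat.Properties
  using (≤-refl; ≤-reflexive; n≤1+n; ≤-pred; ≤-trans; <⇒≤; <⇒≱; +-mono-≤; m≤n⇒m≤1+n; m<m+n;
         +-suc; *-comm;
         ∣n-n∣≡0; ∣-∣-comm; ∣-∣-triangle; ∣m-m+n∣≡n; +-comm; anyUpTo?)
open import Data.Nat.Induction using (<-rec)
open import Data.Fin as Fin using (Fin; toℕ; fromℕ; fromℕ<; punchIn; inject≤; _≟_)
open import Data.Fin.Properties
  using (toℕ<n; toℕ-fromℕ; toℕ-fromℕ<; ≤∧≢⇒<; punchInᵢ≢i; punchIn-injective; inject≤-injective;
         any?; all?)
open import Data.List as List using (List; []; _∷_; length)
open import Data.List.Properties using (filter-reject; filter-idem; filter-all; length-filter; length-tabulate)
open import Data.List.Membership.Propositional using (_∈_)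
open import Data.List.Membership.Propositional.Properties using (∈-filter⁺)
open import Data.List.Relation.Unary.All as All using (All; []; _∷_)
open import Data.List.Relation.Unary.All.Properties using (all-filter; filter⁺; tabulate⁺)
open import Data.List.Relation.Unary.Any using (here; there)
open import Data.List.Relation.Unary.AllPairs using ([]; _∷_)
open import Data.List.Relation.Unary.Unique.Propositional using (Unique)
import Data.List.Relation.Unary.Unique.Propositional.Properties as Unique
open import Data.List.Relation.Binary.Pointwise as Pointwise using (Pointwise; []; _∷_; Pointwise-length)
open import Data.Vec as Vec using (Vec; toList; replicate)
open import Data.Vec.Properties using (length-toList)
open import Data.Product using (Σ; ∃; _×_; _,_; proj₁; proj₂)
open import Data.Sum using (inj₁; inj₂)
open import Data.Unit using (tt)
open import Data.Empty using (⊥-elim)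
open import Function using (_∘_)
open import Relation.Binary.Definitions using (Decidable)
open import Relation.Binary.PropositionalEquality
open import Relation.Nullary using (¬_; Dec; yes; no)
open import Relation.Nullary.Decidable using (¬?; map′; _×-dec_; _⊎-dec_; _→-dec_)
import Relation.Unary as U

module _ {n : ℕ} where

  capture-here : ∀ (c : Fin n) xs → capture c (c ∷ xs) ≡ capture c xs
  capture-here c xs = filter-reject (λ r → ¬? (r ≟ c)) (λ c≢c → c≢c refl)

  capture-idem : ∀ (c : Fin n) xs → capture c (capture c xs) ≡ capture c xs
  capture-idem c = filter-idem (λ r → ¬? (r ≟ c))

  capture-fresh : ∀ {c : Fin n} {xs} → All (λ x → x ≢ c) xs → capture c xs ≡ xs
  capture-fresh {c} = filter-all (λ r → ¬? (r ≟ c))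

  length-capture : ∀ (c : Fin n) xs → length (capture c xs) ≤ length xs
  length-capture c = length-filter (λ r → ¬? (r ≟ c))

  capture-All : ∀ {P : Fin n → Set} {c xs} → All P xs → All (λ x → P x × x ≢ c) (capture c xs)
  capture-All {c = c} {xs} ps =
    All.zip (filter⁺ (λ r → ¬? (r ≟ c)) ps , all-filter (λ r → ¬? (r ≟ c)) xs)

  ∈-capture : ∀ {c x : Fin n} {xs} → x ∈ xs → x ∈ c ∷ capture c xs
  ∈-capture {c} {x} x∈xs with x ≟ c
  ... | yes refl = here refl
  ... | no x≢c = there (∈-filter⁺ (λ r → ¬? (r ≟ c)) x∈xs x≢c)

  capture-Unique : ∀ (c : Fin n) {xs} → Unique xs → Unique (capture c xs)
  capture-Unique c = Unique.filter⁺ (λ r → ¬? (r ≟ c))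

  length-capture-Unique : ∀ (c : Fin n) {xs} → Unique xs → length xs ≤ suc (length (capture c xs))
  length-capture-Unique c {[]} [] = z≤n
  length-capture-Unique c {x ∷ xs} (x∉xs ∷ u) with x ≟ c
  ... | yes refl = s≤s (≤-reflexive (cong length (sym (capture-fresh (All.map (_∘ sym) x∉xs)))))
  ... | no _ = s≤s (length-capture-Unique c u)

length-round : ∀ {n} {R : Fin n → Fin n → Set} (c : Fin n) {xs ys} →
               Pointwise R (capture c xs) ys → length (capture c ys) ≤ length (capture c xs)
length-round c {xs} {ys} moves = ≤-trans (length-capture c ys) (≤-reflexive (sym (Pointwise-length moves)))

length-round-onto : ∀ {n} {R : Fin n → Fin n → Set} (r : Fin n) {rs ys} →
                    Pointwise R (capture r (r ∷ rs)) ys → length (capture r ys) ≤ length rs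
length-round-onto r {rs} {ys} moves = begin
  length (capture r ys)        ≤⟨ length-round r {r ∷ rs} moves ⟩
  length (capture r (r ∷ rs))  ≡⟨ cong length (capture-here r rs) ⟩
  length (capture r rs)        ≤⟨ length-capture r rs ⟩
  length rs                    ∎
  where open Data.Nat.Properties.≤-Reasoning

length-capture-toList : ∀ {n m} (c : Fin n) (rs : Vec (Fin n) m) → length (capture c (toList rs)) ≤ m
length-capture-toList c rs = ≤-trans (length-capture c (toList rs)) (≤-reflexive (length-toList rs))

toList-tabulate : ∀ {a k} {A : Set a} (f : Fin k → A) → toList (Vec.tabulate f) ≡ List.tabulate f
toList-tabulate {k = zero} f = refl
toList-tabulate {k = suc k} f = cong (f Fin.zero ∷_) (toList-tabulate (f ∘ Fin.suc))

All-Pointwise : ∀ {a} {A : Set a} {P Q : A → Set} {R : A → A → Set} →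
                (∀ {x y} → P x → R x y → Q y) → ∀ {xs ys} → All P xs → Pointwise R xs ys → All Q ys
All-Pointwise f [] [] = []
All-Pointwise f (px ∷ pxs) (r ∷ rs) = f px r ∷ All-Pointwise f pxs rs

IsCapt-intro : ∀ {G m t} → CaptureBy G m t → (∀ {t'} → CaptureBy G m t' → t ≤ t') → IsCapt G m t
IsCapt-intro win lower = win , λ t' t'<t win' → <⇒≱ t'<t (lower win')

module IdleRobbers {G : Graph} (Adj-refl : ∀ u → Adj G u u) where

  Win-idle : ∀ {t c rs} → Win G (suc t) c rs → ∃ λ c' → Adj G c c' × Win G t c' (capture c' rs)
  Win-idle {c = c} done = c , Adj-refl c , done
  Win-idle {rs = rs} (step c' c~c' strategy) =
    c' , c~c' , subst (Win G _ c') (capture-idem c' rs) (strategy (capture c' rs) (Pointwise.refl (Adj-refl _)))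

  Win-Unique⇒length≤ : ∀ {t c rs} → Unique rs → Win G t c rs → length rs ≤ t
  Win-Unique⇒length≤ {rs = []} _ _ = z≤n
  Win-Unique⇒length≤ {zero} {rs = _ ∷ _} _ ()
  Win-Unique⇒length≤ {suc t} u win with Win-idle win
  ... | c' , _ , win' =
    ≤-trans (length-capture-Unique c' u) (s≤s (Win-Unique⇒length≤ (capture-Unique c' u) win'))

  module _ (d : Fin (V G) → Fin (V G) → ℕ)
           (d-self : ∀ u → d u u ≡ 0)
           (d-sym : ∀ u v → d u v ≡ d v u)
           (d-triangle : ∀ u v w → d u w ≤ d u v + d v w)
           (d-Adj : ∀ {u v} → Adj G u v → d u v ≤ 1) where

    Win⇒cop-dist≤ : ∀ {t c rs x} → x ∈ c ∷ rs → Win G t c rs → d c x ≤ t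
    Win⇒cop-dist≤ {t} {c} (here refl) _ = subst (_≤ t) (sym (d-self c)) z≤n
    Win⇒cop-dist≤ (there ()) done
    Win⇒cop-dist≤ {suc t} {c} {x = x} (there x∈rs) win with Win-idle win
    ... | c' , c~c' , win' =
      ≤-trans (d-triangle c c' x) (+-mono-≤ (d-Adj c~c') (Win⇒cop-dist≤ (∈-capture x∈rs) win'))

    Win⇒dist≤ : ∀ {t c rs a b} → a ∈ c ∷ rs → b ∈ c ∷ rs → Win G t c rs → d a b ≤ t
    Win⇒dist≤ (here refl) b∈ win = Win⇒cop-dist≤ b∈ win
    Win⇒dist≤ {t} {a = a} {b} (there a∈rs) (here refl) win =
      subst (_≤ t) (d-sym b a) (Win⇒cop-dist≤ (there a∈rs) win)
    Win⇒dist≤ (there ()) (there _) done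
    Win⇒dist≤ {suc t} (there a∈rs) (there b∈rs) win with Win-idle win
    ... | c' , _ , win' = m≤n⇒m≤1+n (Win⇒dist≤ (∈-capture a∈rs) (∈-capture b∈rs) win')

pathDist : ∀ {n} → Fin n → Fin n → ℕ
pathDist u v = ∣ toℕ u - toℕ v ∣

path-Adj-refl : ∀ {n} (u : Fin n) → Adj (path n) u u
path-Adj-refl _ = inj₁ refl

pathDist-Adj : ∀ {n} {u v : Fin n} → Adj (path n) u v → pathDist u v ≤ 1
pathDist-Adj {u = u} (inj₁ refl) = ≤-trans (≤-reflexive (∣n-n∣≡0 (toℕ u))) z≤n
pathDist-Adj {u = u} (inj₂ (inj₁ v≡1+u)) rewrite v≡1+u = ≤-reflexive (∣n-1+n∣≡1 (toℕ u))
  where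
  ∣n-1+n∣≡1 : ∀ k → ∣ k - suc k ∣ ≡ 1
  ∣n-1+n∣≡1 k = subst (λ l → ∣ k - l ∣ ≡ 1) (+-comm k 1) (∣m-m+n∣≡n k 1)
pathDist-Adj {u = u} {v} (inj₂ (inj₂ u≡1+v)) =
  subst (_≤ 1) (∣-∣-comm (toℕ v) (toℕ u)) (pathDist-Adj {u = v} (inj₂ (inj₁ u≡1+v)))

path-capt-lower : ∀ {n m t} → CaptureBy (path (suc n)) (2 + m) t → n ≤ t
path-capt-lower {n} {m} {t} (c₀ , win) =
  subst (_≤ t) (toℕ-fromℕ n)
    (Win⇒dist≤ pathDist (∣n-n∣≡0 ∘ toℕ) (λ u v → ∣-∣-comm (toℕ u) (toℕ v))
       (λ u v w → ∣-∣-triangle (toℕ u) (toℕ v) (toℕ w)) pathDist-Adj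
       (∈-capture {xs = toList robbers} (here refl)) (∈-capture {xs = toList robbers} (there (here refl)))
       (win robbers))
  where
  open IdleRobbers {path (suc n)} path-Adj-refl
  robbers : Vec (Fin (suc n)) (2 + m)
  robbers = Fin.zero Vec.∷ fromℕ n Vec.∷ replicate m Fin.zero

path-Adj⇒≤suc : ∀ {n} {u v : Fin n} → Adj (path n) u v → toℕ u ≤ suc (toℕ v)
path-Adj⇒≤suc (inj₁ refl) = n≤1+n _
path-Adj⇒≤suc (inj₂ (inj₁ v≡1+u)) = m≤n⇒m≤1+n (subst (_ ≤_) (sym v≡1+u) (n≤1+n _))
path-Adj⇒≤suc (inj₂ (inj₂ u≡1+v)) = ≤-reflexive u≡1+v

-- The cop steps towards vertex n every round, so no robber can ever get past him.
path-sweep : ∀ {n} k (c : Fin (suc n)) {rs} → toℕ c + k ≡ n → All (c Fin.<_) rs → Win (path (suc n)) k c rs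
path-sweep k c {[]} _ _ = done
path-sweep zero c {r ∷ _} c+0≡n (c<r ∷ _) =
  ⊥-elim (<⇒≱ c<r (subst (toℕ r ≤_) (trans (sym c+0≡n) (+-comm (toℕ c) 0)) (≤-pred (toℕ<n r))))
path-sweep {n} (suc k) c {rs} c+1+k≡n ahead = step c' (inj₂ (inj₁ c'≡1+c)) λ rs' moves →
  path-sweep k c' (trans (cong (_+ k) c'≡1+c) (trans (sym (+-suc (toℕ c) k)) c+1+k≡n))
    (All.map (λ (c'≤r , r≢c') → ≤∧≢⇒< c'≤r (r≢c' ∘ sym))
      (capture-All (All-Pointwise still-ahead (capture-All ahead) moves)))
  where
  c+1<1+n : suc (toℕ c) < suc n
  c+1<1+n = s≤s (subst (toℕ c <_) c+1+k≡n (m<m+n (toℕ c) (s≤s z≤n)))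
  c' = fromℕ< c+1<1+n
  c'≡1+c : toℕ c' ≡ suc (toℕ c)
  c'≡1+c = toℕ-fromℕ< c+1<1+n
  still-ahead : ∀ {r r'} → c Fin.< r × r ≢ c' → Adj (path (suc n)) r r' → c' Fin.≤ r'
  still-ahead {r} (c<r , r≢c') r~r' =
    ≤-pred (≤-trans (≤∧≢⇒< (subst (_≤ toℕ r) (sym c'≡1+c) c<r) (r≢c' ∘ sym)) (path-Adj⇒≤suc r~r'))

path-capt-upper : ∀ {n m} → CaptureBy (path (suc n)) m n
path-capt-upper {n} = Fin.zero , λ rs →
  path-sweep n Fin.zero refl (All.map 0<r (all-filter (λ r → ¬? (r ≟ Fin.zero)) (toList rs)))
  where
  0<r : ∀ {r : Fin (suc n)} → r ≢ Fin.zero → Fin.zero {n} Fin.< r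
  0<r {Fin.zero} r≢0 = ⊥-elim (r≢0 refl)
  0<r {Fin.suc r} _ = s≤s z≤n

Win-complete : ∀ {G} → (∀ u v → Adj G u v) → ∀ {t c rs} → length rs ≤ t → Win G t c rs
Win-complete Adj-all {rs = []} _ = done
Win-complete Adj-all {suc t} {rs = r ∷ rs} (s≤s rs≤t) = step r (Adj-all _ _) λ rs' moves →
  Win-complete Adj-all (≤-trans (length-round-onto r moves) rs≤t)

complete-capt-upper : ∀ {n m} → CaptureBy (complete (suc n)) m m
complete-capt-upper = Fin.zero , λ rs → Win-complete (λ _ _ → tt) (length-capture-toList Fin.zero rs)

complete-capt-lower : ∀ {n m t} → m ≤ n → CaptureBy (complete (suc n)) m t → m ≤ t
complete-capt-lower {n} {m} {t} m≤n (c₀ , win) =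
  subst (_≤ t) (length-tabulate robber) (Win-Unique⇒length≤ distinct win')
  where
  open IdleRobbers {complete (suc n)} (λ _ → tt)
  robber : Fin m → Fin (suc n)
  robber i = punchIn c₀ (inject≤ i m≤n)
  distinct : Unique (List.tabulate robber)
  distinct = Unique.tabulate⁺ (λ {i} {j} eq → inject≤-injective m≤n m≤n i j (punchIn-injective c₀ _ _ eq))
  win' : Win (complete (suc n)) t c₀ (List.tabulate robber)
  win' = subst (Win (complete (suc n)) t c₀)
           (trans (cong (capture c₀) (toList-tabulate robber))
                  (capture-fresh (tabulate⁺ (λ i → punchInᵢ≢i c₀ (inject≤ i m≤n)))))
           (win (Vec.tabulate robber))

module Dominating {G : Graph} (h : Fin (V G)) (h-dominating : ∀ v → Adj G h v × Adj G v h) where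

  -- Times are written k * 2 so that suc k * 2 reduces to suc (suc (k * 2)).
  mutual
    Win-from-hub : ∀ k {rs} → length rs ≤ suc k → Win G (suc (k * 2)) h rs
    Win-from-hub k {[]} _ = done
    Win-from-hub k {r ∷ rs} (s≤s rs≤k) = step r (h-dominating r .proj₁) λ rs' moves →
      Win-to-hub k (≤-trans (length-round-onto r moves) rs≤k)

    Win-to-hub : ∀ k {c rs} → length rs ≤ k → Win G (k * 2) c rs
    Win-to-hub k {rs = []} _ = done
    Win-to-hub (suc k) {c} {rs = rs@(_ ∷ _)} rs≤1+k = step h (h-dominating c .proj₂) λ rs' moves →
      Win-from-hub k (≤-trans (length-round h {rs} moves) (≤-trans (length-capture h rs) rs≤1+k))

  hub-capt-upper : ∀ m → CaptureBy G (suc m) (2 * suc m ∸ 1)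
  hub-capt-upper m = h , λ rs → subst (λ t → Win G t h (capture h (toList rs))) (cong (_∸ 1) (*-comm (suc m) 2))
    (Win-from-hub m (length-capture-toList h rs))

wheel-hub-dominating : ∀ {n} (v : Fin (suc n)) → Adj (wheel (suc n)) Fin.zero v × Adj (wheel (suc n)) v Fin.zero
wheel-hub-dominating v = inj₂ (inj₁ tt) , inj₂ (inj₂ tt)

all-Pointwise? : ∀ {a k} {A : Set a} {R : A → Fin k → Set} {P : List (Fin k) → Set} →
                 Decidable R → (∀ ys → Dec (P ys)) → ∀ xs → Dec (∀ ys → Pointwise R xs ys → P ys)
all-Pointwise? R? P? [] = map′ (λ p → λ { [] [] → p }) (λ ∀P → ∀P [] []) (P? [])
all-Pointwise? R? P? (x ∷ xs) =
  map′ (λ ∀P → λ { (y ∷ ys) (r ∷ rs) → ∀P y r ys rs }) (λ ∀P y r ys rs → ∀P (y ∷ ys) (r ∷ rs))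
    (all? λ y → R? x y →-dec all-Pointwise? R? (λ ys → P? (y ∷ ys)) xs)

all-Vec? : ∀ {k} m {P : Vec (Fin k) m → Set} → (∀ v → Dec (P v)) → Dec (∀ v → P v)
all-Vec? zero P? = map′ (λ p → λ { Vec.[] → p }) (λ ∀P → ∀P Vec.[]) (P? Vec.[])
all-Vec? (suc m) P? =
  map′ (λ ∀P → λ { (y Vec.∷ ys) → ∀P y ys }) (λ ∀P y ys → ∀P (y Vec.∷ ys))
    (all? λ y → all-Vec? m (λ ys → P? (y Vec.∷ ys)))

module _ {G : Graph} (Adj? : Decidable (Adj G)) where

  Win? : ∀ t c rs → Dec (Win G t c rs)
  Win? t c [] = yes done
  Win? zero c (_ ∷ _) = no λ ()
  Win? (suc t) c rs@(_ ∷ _) =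
    map′ (λ (c' , c~c' , strategy) → step c' c~c' strategy)
         (λ { (step c' c~c' strategy) → c' , c~c' , strategy })
      (any? λ c' → Adj? c c' ×-dec all-Pointwise? Adj? (λ rs' → Win? t c' (capture c' rs')) (capture c' rs))

  CaptureBy? : ∀ m t → Dec (CaptureBy G m t)
  CaptureBy? m t = any? λ c₀ → all-Vec? m (λ rs → Win? t c₀ (capture c₀ (toList rs)))

module _ {P : ℕ → Set} (P? : U.Decidable P) where

  Least≤ : ℕ → Set
  Least≤ T = ∃ λ t → (P t × (∀ t' → t' < t → ¬ P t')) × t ≤ T

  least : ∀ T → P T → Least≤ T
  least = <-rec (λ T → P T → Least≤ T) search
    where
    search : ∀ T → (∀ {T'} → T' < T → P T' → Least≤ T') → P T → Least≤ T
    search T below PT with anyUpTo? P? T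
    ... | yes (T' , T'<T , PT') with below T'<T PT'
    ...   | t , minimal , t≤T' = t , minimal , ≤-trans t≤T' (<⇒≤ T'<T)
    search T below PT | no none = T , (PT , λ t' t'<T Pt' → none (t' , t'<T , Pt')) , ≤-refl

capt≤ : ∀ {G m T} → Decidable (Adj G) → CaptureBy G m T → Σ ℕ λ t → IsCapt G m t × t ≤ T
capt≤ Adj? = least (CaptureBy? Adj? _) _

wheel-Adj? : ∀ n → Decidable (Adj (wheel n))
wheel-Adj? _ u v = (u ≟ v) ⊎-dec (wheelEdge? u v ⊎-dec wheelEdge? v u)
  where
  cycleEdge? : ∀ {k} (i j : Fin k) → Dec (cycleEdge i j)
  cycleEdge? {k} i j =
    (toℕ j Data.Nat.≟ suc (toℕ i)) ⊎-dec ((toℕ i Data.Nat.≟ k ∸ 1) ×-dec (toℕ j Data.Nat.≟ 0))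
  wheelEdge? : ∀ {n} (i j : Fin n) → Dec (wheelEdge i j)
  wheelEdge? Fin.zero _ = yes tt
  wheelEdge? (Fin.suc _) Fin.zero = yes tt
  wheelEdge? (Fin.suc i) (Fin.suc j) = cycleEdge? i j

theorem3p8 :
    (∀ (n m : ℕ) → 1 ≤ n → 2 ≤ m → IsCapt (path n) m (n ∸ 1))
    × (∀ (n m : ℕ) → 2 ≤ n → 1 ≤ m → m ≤ n ∸ 1 → IsCapt (complete n) m m)
    × (∀ (n m : ℕ) → 4 ≤ n → 1 ≤ m → m ≤ n ∸ 1 →
         Σ ℕ (λ t → IsCapt (wheel n) m t × t ≤ 2 * m ∸ 1))
theorem3p8 = path-capt , complete-capt , wheel-capt
  where
  path-capt : ∀ (n m : ℕ) → 1 ≤ n → 2 ≤ m → IsCapt (path n) m (n ∸ 1)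
  path-capt (suc n) 1 _ (s≤s ())
  path-capt (suc n) (suc (suc m)) _ _ = IsCapt-intro path-capt-upper path-capt-lower
  complete-capt : ∀ (n m : ℕ) → 2 ≤ n → 1 ≤ m → m ≤ n ∸ 1 → IsCapt (complete n) m m
  complete-capt (suc n) m _ _ m≤n =
    IsCapt-intro complete-capt-upper (complete-capt-lower m≤n)
  wheel-capt : ∀ (n m : ℕ) → 4 ≤ n → 1 ≤ m → m ≤ n ∸ 1 →
               Σ ℕ (λ t → IsCapt (wheel n) m t × t ≤ 2 * m ∸ 1)
  wheel-capt (suc n) (suc m) _ _ _ =
    capt≤ (wheel-Adj? (suc n)) (Dominating.hub-capt-upper Fin.zero wheel-hub-dominating m)
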